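{- Let $n\ge 1$ and $0\le k\le n$. (i) If $S$ is a collection of $k+1$ distinct subsets of $[n]$, each of size at least $k$, then $|\partial^-(S)|\ge 2^{k+1}-1$. (ii) If $S'$ is a collection of $k$ distinct subsets of $[n]$, each of size at least $k$, then $|\partial^-(S')|\ge 2^{k+1}-2$. (iii) If $S$ is a collection of $n-k+1$ distinct subsets of $[n]$, each of size at most $k$, then $|\partial^+(S)|\ge 2^{n-k+1}-1$. (iv) If $S'$ is a collection of $n-k$ distinct subsets of $[n]$, each of size at most $k$, then $|\partial^+(S')|\ge 2^{n-k+1}-2$.
   Context: For a family $\mathcal{G}$ of subsets of $[n]$, $\partial^+(\mathcal{G})=\{X\subseteq[n]: G\subseteq X\text{ for some }G\in\mathcal{G}\}$ and $\partial^-(\mathcal{G})=\{X\subseteq[n]: X\subseteq G\text{ for some }G\in\mathcal{G}\}$. -}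

module Defs where

open import Data.Nat using (ℕ; zero; suc)
open import Data.Vec using ([]; _∷_)
open import Data.List using (List; []; _∷_; [_]; map; _++_; filter; length)
open import Data.List.Relation.Unary.Any using (any?)
open import Data.Fin.Subset using (Subset; inside; outside)
open import Data.Fin.Subset.Properties using (_⊆?_)

allSubsets : (n : ℕ) → List (Subset n)
allSubsets zero = [ [] ]
allSubsets (suc n) = map (outside ∷_) (allSubsets n) ++ map (inside ∷_) (allSubsets n)

downSet : {n : ℕ} → List (Subset n) → List (Subset n)
downSet {n} 𝒢 = filter (λ X → any? (λ G → X ⊆? G) 𝒢) (allSubsets n)

upSet : {n : ℕ} → List (Subset n) → List (Subset n)
upSet {n} 𝒢 = filter (λ X → any? (λ G → G ⊆? X) 𝒢) (allSubsets n)

∣∂⁻_∣ : {n : ℕ} → List (Subset n) → ℕ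
∣∂⁻ 𝒢 ∣ = length (downSet 𝒢)

∣∂⁺_∣ : {n : ℕ} → List (Subset n) → ℕ
∣∂⁺ 𝒢 ∣ = length (upSet 𝒢)

{-# OPTIONS --safe #-}
-- Split a family S of subsets of [n+1] by the first point: the members avoiding it
-- give a family S₀ of sets of size ≥ k in [n], those containing it a family S₁ of
-- sets of size ≥ k − 1. Below every member of S₀ ∪ S₁ lie lower-shadow elements
-- avoiding the first point, and below every member of S₁ also ones containing it,
-- so |∂⁻ S| ≥ |∂⁻ (S₀ ∪ S₁)| + |∂⁻ S₁|. By induction, m distinct sets of size ≥ k
-- have a lower shadow of size at least 2^k + 2^(k−1) + ⋯ (m terms, exponents
-- truncated at 0), which is 2^(k+1) − 1 for m = k + 1 and 2^(k+1) − 2 for m = k.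
-- Complementation exchanges ∂⁺ and ∂⁻ and turns size ≤ k into size ≥ n − k.
module Submission where

open import Defs
open import Data.Bool using (true; false)
open import Data.Nat using (ℕ; zero; suc; _+_; _*_; _≤_; _∸_; _^_; _⊔_; z≤n; s≤s)
open import Data.Nat.Properties
open import Data.Bool.Properties using (not-injective)
open import Data.Product using (_×_; _,_)
open import Data.Sum using ([_,_]′)
open import Data.Vec using ([]; _∷_)
import Data.Vec.Properties as Vec
open import Data.List using (List; []; _∷_; _++_; map; filter; length)
open import Data.List.Properties using (length-++; length-map; filter-++; filter-≐)
open import Data.List.Relation.Unary.All using (All; []; _∷_)
import Data.List.Relation.Unary.All as All
import Data.List.Relation.Unary.All.Properties as All
open import Data.List.Relation.Unary.Any using (Any; here; there)
import Data.List.Relation.Unary.Any as Any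
import Data.List.Relation.Unary.Any.Properties as Any
open import Data.List.Relation.Unary.AllPairs using ([]; _∷_)
open import Data.List.Relation.Unary.Unique.Propositional using (Unique)
import Data.List.Relation.Unary.Unique.Propositional.Properties as Unique
open import Data.List.Relation.Binary.Subset.Propositional as List using ()
open import Data.List.Relation.Binary.Subset.Propositional.Properties
  using (Any-resp-⊆; xs⊆xs++ys; xs⊆ys++xs)
open import Data.List.Relation.Binary.Sublist.Heterogeneous.Properties
  using (length-mono-≤; ⊆-filter-Sublist)
open import Data.List.Relation.Binary.Sublist.Propositional using (⊆-refl)
open import Data.Fin.Subset using (Subset; _⊆_; ∁; ∣_∣; inside; outside)
open import Data.Fin.Subset.Properties
  using (_⊆?_; out⊆; in⊆in; ∣∁p∣≡n∸∣p∣; p⊆q⇒∁p⊇∁q; ∁p⊆∁q⇒p⊇q)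
open import Function using (_∘_; id)
open import Level using (Level)
open import Relation.Nullary using (does; contradiction)
open import Relation.Unary using (Pred; Decidable)
open import Relation.Binary.PropositionalEquality
  using (_≡_; refl; sym; cong; cong₂; subst; module ≡-Reasoning)

private
  variable
    a ℓ : Level
    A B : Set a
    n : ℕ

powSum : ℕ → ℕ → ℕ
powSum zero    k = 0
powSum (suc m) k = 2 ^ k + powSum m (k ∸ 1)

powSum-+ : ∀ a b k → powSum (a + b) k ≡ powSum a k + powSum b (k ∸ a)
powSum-+ zero    b k = refl
powSum-+ (suc a) b k = begin
  2 ^ k + powSum (a + b) (k ∸ 1)                      ≡⟨ cong (2 ^ k +_) (powSum-+ a b (k ∸ 1)) ⟩
  2 ^ k + (powSum a (k ∸ 1) + powSum b (k ∸ 1 ∸ a))   ≡⟨ +-assoc (2 ^ k) _ _ ⟨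
  2 ^ k + powSum a (k ∸ 1) + powSum b (k ∸ 1 ∸ a)     ≡⟨ cong (λ j → powSum (suc a) k + powSum b j) (∸-+-assoc k 1 a) ⟩
  powSum (suc a) k + powSum b (k ∸ suc a)             ∎
  where open ≡-Reasoning

powSum-mono : ∀ m {k l} → k ≤ l → powSum m k ≤ powSum m l
powSum-mono zero    k≤l = z≤n
powSum-mono (suc m) k≤l = +-mono-≤ (^-monoʳ-≤ 2 k≤l) (powSum-mono m (∸-monoˡ-≤ 1 k≤l))

powSum≤2*powSum : ∀ m k → powSum m k ≤ 2 * powSum m (k ∸ 1)
powSum≤2*powSum zero    k = z≤n
powSum≤2*powSum (suc m) k = begin
  2 ^ k + powSum m (k ∸ 1)                        ≤⟨ +-mono-≤ (2^k≤2*2^[k∸1] k) (powSum≤2*powSum m (k ∸ 1)) ⟩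
  2 * 2 ^ (k ∸ 1) + 2 * powSum m (k ∸ 1 ∸ 1)      ≡⟨ *-distribˡ-+ 2 (2 ^ (k ∸ 1)) (powSum m (k ∸ 1 ∸ 1)) ⟨
  2 * powSum (suc m) (k ∸ 1)                      ∎
  where
  open ≤-Reasoning
  2^k≤2*2^[k∸1] : ∀ k → 2 ^ k ≤ 2 * 2 ^ (k ∸ 1)
  2^k≤2*2^[k∸1] zero    = s≤s z≤n
  2^k≤2*2^[k∸1] (suc k) = ≤-refl

powSum-split : ∀ a b k → powSum (a + b) k ≤ (powSum a k ⊔ powSum b (k ∸ 1)) + powSum b (k ∸ 1)
powSum-split zero    b k = begin
  powSum b k                            ≤⟨ powSum≤2*powSum b k ⟩
  2 * powSum b (k ∸ 1)                  ≡⟨ cong (powSum b (k ∸ 1) +_) (+-identityʳ _) ⟩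
  powSum b (k ∸ 1) + powSum b (k ∸ 1)   ∎
  where open ≤-Reasoning
powSum-split (suc a) b k = begin
  powSum (suc a + b) k                                      ≡⟨ powSum-+ (suc a) b k ⟩
  powSum (suc a) k + powSum b (k ∸ suc a)
    ≤⟨ +-mono-≤ (m≤m⊔n _ _) (powSum-mono b (∸-monoʳ-≤ k (s≤s z≤n))) ⟩
  (powSum (suc a) k ⊔ powSum b (k ∸ 1)) + powSum b (k ∸ 1)  ∎
  where open ≤-Reasoning

powSum-closed : ∀ m k → m ≤ suc k → powSum m k + 2 ^ (suc k ∸ m) ≡ 2 ^ suc k
powSum-closed zero    k       _         = refl
powSum-closed (suc m) zero    (s≤s z≤n) = refl
powSum-closed (suc m) (suc k) (s≤s m≤1+k) = begin
  2 ^ suc k + powSum m k + 2 ^ (suc k ∸ m)     ≡⟨ +-assoc (2 ^ suc k) _ _ ⟩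
  2 ^ suc k + (powSum m k + 2 ^ (suc k ∸ m))   ≡⟨ cong (2 ^ suc k +_) (powSum-closed m k m≤1+k) ⟩
  2 ^ suc k + 2 ^ suc k                        ≡⟨ cong (2 ^ suc k +_) (+-identityʳ (2 ^ suc k)) ⟨
  2 ^ suc (suc k)                              ∎
  where open ≡-Reasoning

2^[1+k]∸2^j≡powSum : ∀ j k → j ≤ suc k → 2 ^ suc k ∸ 2 ^ j ≡ powSum (suc k ∸ j) k
2^[1+k]∸2^j≡powSum j k j≤1+k = begin
  2 ^ suc k ∸ 2 ^ j                              ≡⟨ cong (_∸ 2 ^ j) (powSum-closed m k (m∸n≤m (suc k) j)) ⟨
  powSum m k + 2 ^ (suc k ∸ m) ∸ 2 ^ j           ≡⟨ cong (λ i → powSum m k + 2 ^ i ∸ 2 ^ j) (m∸[m∸n]≡n j≤1+k) ⟩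
  powSum m k + 2 ^ j ∸ 2 ^ j                     ≡⟨ m+n∸n≡m (powSum m k) (2 ^ j) ⟩
  powSum m k                                     ∎
  where
  open ≡-Reasoning
  m = suc k ∸ j

module _ {P : Pred B ℓ} (P? : Decidable P) where

  length-filter-map : ∀ (f : A → B) xs → length (filter P? (map f xs)) ≡ length (filter (P? ∘ f) xs)
  length-filter-map f []       = refl
  length-filter-map f (x ∷ xs) with does (P? (f x))
  ... | true  = cong suc (length-filter-map f xs)
  ... | false = length-filter-map f xs

length-filter-mono : ∀ {P Q : Pred A ℓ} (P? : Decidable P) (Q? : Decidable Q) →
                     (∀ {x} → P x → Q x) → ∀ xs → length (filter P? xs) ≤ length (filter Q? xs)
length-filter-mono P? Q? P⇒Q xs = length-mono-≤ (⊆-filter-Sublist P? Q? (λ { refl → P⇒Q }) (⊆-refl {x = xs}))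

countSubsets : {P : Pred (Subset n) ℓ} → Decidable P → ℕ
countSubsets {n} P? = length (filter P? (allSubsets n))

module _ {P : Pred (Subset (suc n)) ℓ} (P? : Decidable P) where

  countSubsets-suc : countSubsets P? ≡ countSubsets (P? ∘ (outside ∷_)) + countSubsets (P? ∘ (inside ∷_))
  countSubsets-suc = begin
    length (filter P? (map (outside ∷_) all ++ map (inside ∷_) all))
      ≡⟨ cong length (filter-++ P? (map (outside ∷_) all) _) ⟩
    length (filter P? (map (outside ∷_) all) ++ filter P? (map (inside ∷_) all))
      ≡⟨ length-++ (filter P? (map (outside ∷_) all)) ⟩
    length (filter P? (map (outside ∷_) all)) + length (filter P? (map (inside ∷_) all))
      ≡⟨ cong₂ _+_ (length-filter-map P? (outside ∷_) all) (length-filter-map P? (inside ∷_) all) ⟩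
    countSubsets (P? ∘ (outside ∷_)) + countSubsets (P? ∘ (inside ∷_))
      ∎
    where
    open ≡-Reasoning
    all = allSubsets n

countSubsets-mono : ∀ {P Q : Pred (Subset n) ℓ} (P? : Decidable P) (Q? : Decidable Q) →
                    (∀ {X} → P X → Q X) → countSubsets P? ≤ countSubsets Q?
countSubsets-mono {n} P? Q? P⇒Q = length-filter-mono P? Q? P⇒Q (allSubsets n)

countSubsets-∘∁ : ∀ {P : Pred (Subset n) ℓ} (P? : Decidable P) → countSubsets (P? ∘ ∁) ≡ countSubsets P?
countSubsets-∘∁ {zero}  P? with does (P? [])
... | true  = refl
... | false = refl
countSubsets-∘∁ {suc n} P? = begin
  countSubsets (P? ∘ ∁)
    ≡⟨ countSubsets-suc (P? ∘ ∁) ⟩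
  countSubsets (P? ∘ (inside ∷_) ∘ ∁) + countSubsets (P? ∘ (outside ∷_) ∘ ∁)
    ≡⟨ cong₂ _+_ (countSubsets-∘∁ (P? ∘ (inside ∷_))) (countSubsets-∘∁ (P? ∘ (outside ∷_))) ⟩
  countSubsets (P? ∘ (inside ∷_)) + countSubsets (P? ∘ (outside ∷_))
    ≡⟨ +-comm (countSubsets (P? ∘ (inside ∷_))) _ ⟩
  countSubsets (P? ∘ (outside ∷_)) + countSubsets (P? ∘ (inside ∷_))
    ≡⟨ countSubsets-suc P? ⟨
  countSubsets P?
    ∎
  where open ≡-Reasoning

outsideTails : List (Subset (suc n)) → List (Subset n)
outsideTails []                  = []
outsideTails ((outside ∷ x) ∷ S) = x ∷ outsideTails S
outsideTails ((inside  ∷ x) ∷ S) = outsideTails S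

insideTails : List (Subset (suc n)) → List (Subset n)
insideTails []                  = []
insideTails ((outside ∷ x) ∷ S) = insideTails S
insideTails ((inside  ∷ x) ∷ S) = x ∷ insideTails S

length-tails : (S : List (Subset (suc n))) → length S ≡ length (outsideTails S) + length (insideTails S)
length-tails []                  = refl
length-tails ((outside ∷ x) ∷ S) = cong suc (length-tails S)
length-tails ((inside  ∷ x) ∷ S) = begin
  suc (length S)                                           ≡⟨ cong suc (length-tails S) ⟩
  suc (length (outsideTails S) + length (insideTails S))   ≡⟨ +-suc (length (outsideTails S)) _ ⟨
  length (outsideTails S) + suc (length (insideTails S))   ∎
  where open ≡-Reasoning

module _ {P : Pred (Subset (suc n)) ℓ} {Q : Pred (Subset n) ℓ} where

  All-outsideTails : (∀ {x} → P (outside ∷ x) → Q x) → ∀ {S} → All P S → All Q (outsideTails S)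
  All-outsideTails P⇒Q {[]}                  []         = []
  All-outsideTails P⇒Q {(outside ∷ x) ∷ S} (px ∷ pS) = P⇒Q px ∷ All-outsideTails P⇒Q pS
  All-outsideTails P⇒Q {(inside  ∷ x) ∷ S} (px ∷ pS) = All-outsideTails P⇒Q pS

  All-insideTails : (∀ {x} → P (inside ∷ x) → Q x) → ∀ {S} → All P S → All Q (insideTails S)
  All-insideTails P⇒Q {[]}                  []         = []
  All-insideTails P⇒Q {(outside ∷ x) ∷ S} (px ∷ pS) = All-insideTails P⇒Q pS
  All-insideTails P⇒Q {(inside  ∷ x) ∷ S} (px ∷ pS) = P⇒Q px ∷ All-insideTails P⇒Q pS

  Any-outsideTails : (∀ {x} → Q x → P (outside ∷ x)) → ∀ {S} → Any Q (outsideTails S) → Any P S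
  Any-outsideTails Q⇒P {(outside ∷ x) ∷ S} (here qx) = here (Q⇒P qx)
  Any-outsideTails Q⇒P {(outside ∷ x) ∷ S} (there q) = there (Any-outsideTails Q⇒P q)
  Any-outsideTails Q⇒P {(inside  ∷ x) ∷ S} q         = there (Any-outsideTails Q⇒P q)

  Any-insideTails : (∀ {x} → Q x → P (inside ∷ x)) → ∀ {S} → Any Q (insideTails S) → Any P S
  Any-insideTails Q⇒P {(outside ∷ x) ∷ S} q         = there (Any-insideTails Q⇒P q)
  Any-insideTails Q⇒P {(inside  ∷ x) ∷ S} (here qx) = here (Q⇒P qx)
  Any-insideTails Q⇒P {(inside  ∷ x) ∷ S} (there q) = there (Any-insideTails Q⇒P q)

Unique-outsideTails : {S : List (Subset (suc n))} → Unique S → Unique (outsideTails S)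
Unique-outsideTails {S = []}                  []          = []
Unique-outsideTails {S = (outside ∷ x) ∷ S} (x∉S ∷ uS) =
  All-outsideTails (λ x≢y x≡y → x≢y (cong (outside ∷_) x≡y)) x∉S ∷ Unique-outsideTails uS
Unique-outsideTails {S = (inside  ∷ x) ∷ S} (_   ∷ uS) = Unique-outsideTails uS

Unique-insideTails : {S : List (Subset (suc n))} → Unique S → Unique (insideTails S)
Unique-insideTails {S = []}                  []          = []
Unique-insideTails {S = (outside ∷ x) ∷ S} (_   ∷ uS) = Unique-insideTails uS
Unique-insideTails {S = (inside  ∷ x) ∷ S} (x∉S ∷ uS) =
  All-insideTails (λ x≢y x≡y → x≢y (cong (inside ∷_) x≡y)) x∉S ∷ Unique-insideTails uS

∂⁻? : (S : List (Subset n)) → Decidable (λ X → Any (X ⊆_) S)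
∂⁻? S X = Any.any? (X ⊆?_) S

∣∂⁻∣-mono : {S T : List (Subset n)} → S List.⊆ T → ∣∂⁻ S ∣ ≤ ∣∂⁻ T ∣
∣∂⁻∣-mono {S = S} {T} S⊆T = countSubsets-mono (∂⁻? S) (∂⁻? T) (Any-resp-⊆ S⊆T)

∣∂⁻∣-split : (S : List (Subset (suc n))) →
             ∣∂⁻ outsideTails S ++ insideTails S ∣ + ∣∂⁻ insideTails S ∣ ≤ ∣∂⁻ S ∣
∣∂⁻∣-split S = begin
  ∣∂⁻ outsideTails S ++ insideTails S ∣ + ∣∂⁻ insideTails S ∣
    ≤⟨ +-mono-≤ (countSubsets-mono (∂⁻? (outsideTails S ++ insideTails S)) (∂⁻? S ∘ (outside ∷_))
                   ([ Any-outsideTails out⊆ {S} , Any-insideTails out⊆ {S} ]′ ∘ Any.++⁻ (outsideTails S)))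
                (countSubsets-mono (∂⁻? (insideTails S)) (∂⁻? S ∘ (inside ∷_)) (Any-insideTails in⊆in)) ⟩
  countSubsets (∂⁻? S ∘ (outside ∷_)) + countSubsets (∂⁻? S ∘ (inside ∷_))
    ≡⟨ countSubsets-suc (∂⁻? S) ⟨
  ∣∂⁻ S ∣
    ∎
  where open ≤-Reasoning

∁-injective : {p q : Subset n} → ∁ p ≡ ∁ q → p ≡ q
∁-injective {p = []}    {[]}    _   = refl
∁-injective {p = x ∷ p} {y ∷ q} eq =
  cong₂ _∷_ (not-injective (Vec.∷-injectiveˡ eq)) (∁-injective (Vec.∷-injectiveʳ eq))

∣∂⁺∣≡∣∂⁻∁∣ : (S : List (Subset n)) → ∣∂⁺ S ∣ ≡ ∣∂⁻ map ∁ S ∣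
∣∂⁺∣≡∣∂⁻∁∣ {n} S = begin
  ∣∂⁺ S ∣                           ≡⟨ cong length (filter-≐ ∂⁺? (∂⁻? (map ∁ S) ∘ ∁) (to , from) (allSubsets n)) ⟩
  countSubsets (∂⁻? (map ∁ S) ∘ ∁)  ≡⟨ countSubsets-∘∁ (∂⁻? (map ∁ S)) ⟩
  ∣∂⁻ map ∁ S ∣                     ∎
  where
  open ≡-Reasoning
  ∂⁺? : Decidable (λ X → Any (_⊆ X) S)
  ∂⁺? X = Any.any? (_⊆? X) S
  to : ∀ {X} → Any (_⊆ X) S → Any (∁ X ⊆_) (map ∁ S)
  to = Any.map⁺ ∘ Any.map p⊆q⇒∁p⊇∁q
  from : ∀ {X} → Any (∁ X ⊆_) (map ∁ S) → Any (_⊆ X) S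
  from = Any.map ∁p⊆∁q⇒p⊇q ∘ Any.map⁻

powSum≤∣∂⁻∣ : ∀ {k} (S : List (Subset n)) → Unique S → All (λ G → k ≤ ∣ G ∣) S →
              powSum (length S) k ≤ ∣∂⁻ S ∣
powSum≤∣∂⁻∣ {zero}  []             _                  _           = z≤n
powSum≤∣∂⁻∣ {zero}  ([] ∷ [])      _                  (z≤n ∷ [])  = ≤-refl
powSum≤∣∂⁻∣ {zero}  ([] ∷ [] ∷ _)  ((≢[] ∷ _) ∷ _)    _           = contradiction refl ≢[]
powSum≤∣∂⁻∣ {suc n} {k} S uS bigS = begin
  powSum (length S) k                                   ≡⟨ cong (λ m → powSum m k) (length-tails S) ⟩
  powSum (length S₀ + length S₁) k                      ≤⟨ powSum-split (length S₀) (length S₁) k ⟩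
  (powSum (length S₀) k ⊔ powSum (length S₁) (k ∸ 1))
    + powSum (length S₁) (k ∸ 1)                        ≤⟨ +-mono-≤ (⊔-lub bound₀ bound₁′) bound₁ ⟩
  ∣∂⁻ S₀ ++ S₁ ∣ + ∣∂⁻ S₁ ∣                             ≤⟨ ∣∂⁻∣-split S ⟩
  ∣∂⁻ S ∣                                               ∎
  where
  open ≤-Reasoning
  S₀ = outsideTails S
  S₁ = insideTails S
  bound₁ : powSum (length S₁) (k ∸ 1) ≤ ∣∂⁻ S₁ ∣
  bound₁ = powSum≤∣∂⁻∣ S₁ (Unique-insideTails uS) (All-insideTails (∸-monoˡ-≤ 1) bigS)
  bound₁′ : powSum (length S₁) (k ∸ 1) ≤ ∣∂⁻ S₀ ++ S₁ ∣
  bound₁′ = ≤-trans bound₁ (∣∂⁻∣-mono (xs⊆ys++xs S₁ S₀))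
  bound₀ : powSum (length S₀) k ≤ ∣∂⁻ S₀ ++ S₁ ∣
  bound₀ = ≤-trans (powSum≤∣∂⁻∣ S₀ (Unique-outsideTails uS) (All-outsideTails id bigS))
                   (∣∂⁻∣-mono (xs⊆xs++ys S₀ S₁))

powSum≤∣∂⁺∣ : ∀ {k} (S : List (Subset n)) → Unique S → All (λ G → ∣ G ∣ ≤ k) S →
              powSum (length S) (n ∸ k) ≤ ∣∂⁺ S ∣
powSum≤∣∂⁺∣ {n} {k} S uS smallS = begin
  powSum (length S) (n ∸ k)           ≡⟨ cong (λ m → powSum m (n ∸ k)) (length-map ∁ S) ⟨
  powSum (length (map ∁ S)) (n ∸ k)   ≤⟨ powSum≤∣∂⁻∣ (map ∁ S) (Unique.map⁺ ∁-injective uS) big∁S ⟩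
  ∣∂⁻ map ∁ S ∣                       ≡⟨ ∣∂⁺∣≡∣∂⁻∁∣ S ⟨
  ∣∂⁺ S ∣                             ∎
  where
  open ≤-Reasoning
  big∁ : (G : Subset n) → ∣ G ∣ ≤ k → n ∸ k ≤ ∣ ∁ G ∣
  big∁ G ∣G∣≤k = subst (n ∸ k ≤_) (sym (∣∁p∣≡n∸∣p∣ G)) (∸-monoʳ-≤ n ∣G∣≤k)
  big∁S : All (λ G → n ∸ k ≤ ∣ G ∣) (map ∁ S)
  big∁S = All.map⁺ (All.map (λ {G} → big∁ G) smallS)

lemma4p7 : (n k : ℕ) → 1 ≤ n → k ≤ n →
    ((S : List (Subset n)) → Unique S → length S ≡ suc k →
       All (λ G → k ≤ ∣ G ∣) S → 2 ^ suc k ∸ 1 ≤ ∣∂⁻ S ∣)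
    × ((S′ : List (Subset n)) → Unique S′ → length S′ ≡ k →
       All (λ G → k ≤ ∣ G ∣) S′ → 2 ^ suc k ∸ 2 ≤ ∣∂⁻ S′ ∣)
    × ((S : List (Subset n)) → Unique S → length S ≡ suc (n ∸ k) →
       All (λ G → ∣ G ∣ ≤ k) S → 2 ^ suc (n ∸ k) ∸ 1 ≤ ∣∂⁺ S ∣)
    × ((S′ : List (Subset n)) → Unique S′ → length S′ ≡ n ∸ k →
       All (λ G → ∣ G ∣ ≤ k) S′ → 2 ^ suc (n ∸ k) ∸ 2 ≤ ∣∂⁺ S′ ∣)
lemma4p7 n k _ _ =
    (λ S uS ∣S∣≡1+k bigS → closed-form-≤ 0 k z≤n ∣S∣≡1+k (powSum≤∣∂⁻∣ S uS bigS))
  , (λ S uS ∣S∣≡k bigS → closed-form-≤ 1 k (s≤s z≤n) ∣S∣≡k (powSum≤∣∂⁻∣ S uS bigS))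
  , (λ S uS ∣S∣≡1+n-k smallS → closed-form-≤ 0 (n ∸ k) z≤n ∣S∣≡1+n-k (powSum≤∣∂⁺∣ S uS smallS))
  , (λ S uS ∣S∣≡n-k smallS → closed-form-≤ 1 (n ∸ k) (s≤s z≤n) ∣S∣≡n-k (powSum≤∣∂⁺∣ S uS smallS))
  where
  closed-form-≤ : ∀ j k {m N} → j ≤ suc k → m ≡ suc k ∸ j → powSum m k ≤ N → 2 ^ suc k ∸ 2 ^ j ≤ N
  closed-form-≤ j k j≤1+k refl m≤N = subst (_≤ _) (sym (2^[1+k]∸2^j≡powSum j k j≤1+k)) m≤N
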